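{- Let $p$ be a prime, $n\ge1$, and let $B=\{[\vec{x},\vec{y},z]:\vec x\in X_1\times\dots\times X_n,\ \vec y\in Y_1\times\dots\times Y_n,\ z\in Z\}\subseteq M_n$ be a brick, with nonempty $X_i,Y_i,Z\subseteq\mathbb{F}_p$. Let $\vec a=(a_1,\dots,a_n),\vec b=(b_1,\dots,b_n)\in\mathbb{F}_p^n$ and suppose \[ |Z|^2\prod_{i=1}^n|X_i\cap(a_i-X_i)|\,|Y_i\cap(b_i-Y_i)|>2p^{n+2}. \] Then $B\cdot B\supseteq[\vec a,\vec b,\mathbb{F}_p]=\{[\vec a,\vec b,z]:z\in\mathbb{F}_p\}$.
   Context: $M_n$ is the group of triples $[\vec{x},\vec{y},z]$, $\vec{x},\vec{y}\in\mathbb{F}_p^n$, $z\in\mathbb{F}_p$, with multiplication $[\vec{x},\vec{y},z]\cdot[\vec{x}',\vec{y}',z']=[\vec{x}+\vec{x}',\vec{y}+\vec{y}',z+z'+\langle\vec{x},\vec{y}'\rangle+f(\vec{y},\vec{y}')]$, where $\langle\vec x,\vec y'\rangle=\sum_i x_iy_i'$ and $f(\vec{y},\vec{y}')=\sum_{i=1}^n\lfloor((y_i\bmod p)+(y_i'\bmod p))/p\rfloor$, with $y\bmod p\in\{0,\dots,p-1\}$ denoting $y\in\mathbb{F}_p$ as an integer. $B\cdot B=\{bb':b,b'\in B\}$, and $a-X=\{a-x:x\in X\}$. -}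

module Defs where

open import Data.Nat using (ℕ; zero; suc; _+_; _*_; _∸_; NonZero)
open import Data.Nat.DivMod using (_mod_; _/_)
open import Data.Nat.Primality using (Prime; prime⇒nonZero)
open import Data.Fin using (Fin; toℕ)
import Data.Fin
open import Data.Fin.Subset using (Subset; _∈_)
open import Data.Vec using (Vec; lookup; tabulate; zipWith)
open import Data.Product using (_×_; _,_)

∏ : (n : ℕ) → (Fin n → ℕ) → ℕ
∏ zero    f = 1
∏ (suc n) f = f Data.Fin.zero * ∏ n (λ i → f (Data.Fin.suc i))


∑ : (n : ℕ) → (Fin n → ℕ) → ℕ
∑ zero    f = 0
∑ (suc n) f = f Data.Fin.zero + ∑ n (λ i → f (Data.Fin.suc i))


module Heis (p : ℕ) (pr : Prime p) (n : ℕ) where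
  instance
    p≢0 : NonZero p
    p≢0 = prime⇒nonZero pr

  F : Set
  F = Fin p

  _⊕_ : F → F → F
  x ⊕ y = (toℕ x + toℕ y) mod p

  _⊖_ : F → F → F
  x ⊖ y = (toℕ x + (p ∸ toℕ y)) mod p

  -- a - X = { a - x : x ∈ X }  (t ∈ a - X  iff  a - t ∈ X)
  _-ˢ_ : F → Subset p → Subset p
  a -ˢ X = tabulate (λ t → lookup X (a ⊖ t))

  M : Set
  M = Vec F n × Vec F n × F

  carry : Vec F n → Vec F n → ℕ
  carry y y' = ∑ n (λ i → (toℕ (lookup y i) + toℕ (lookup y' i)) / p)

  inner : Vec F n → Vec F n → ℕ
  inner x y' = ∑ n (λ i → toℕ (lookup x i) * toℕ (lookup y' i))

  _·_ : M → M → M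
  (x , y , z) · (x' , y' , z') =
    zipWith _⊕_ x x' , zipWith _⊕_ y y' ,
    (toℕ z + toℕ z' + inner x y' + carry y y') mod p

  InBrick : (Fin n → Subset p) → (Fin n → Subset p) → Subset p → M → Set
  InBrick X Y Z (x , y , z) =
    (∀ i → lookup x i ∈ X i) × (∀ i → lookup y i ∈ Y i) × z ∈ Z

{-# OPTIONS --safe #-}
-- For x ∈ A = ∏ᵢ Xᵢ ∩ (aᵢ − Xᵢ), w ∈ C = ∏ᵢ Yᵢ ∩ (bᵢ − Yᵢ) and z₁, z₂ ∈ Z, the elements
-- g = [x, b − w, z₁] and h = [a − x, w, z₂] lie in B and g·h = [a, b, z₁ + z₂ + ⟨x, w⟩ + f(b − w, w)],
-- so it suffices to realise every z as such a sum.  Let r_w(s) count the (z₁, x) ∈ Z × A with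
-- z₁ + ⟨x, w⟩ = s and put N = |Z||A|.  If z is never realised, then for w ∈ C the support of r_w
-- misses the |Z| residues z − f(b − w, w) − Z, so Cauchy–Schwarz gives N² ≤ (p − |Z|) Σₛ r_w(s)²;
-- for every w it gives N² ≤ p Σₛ r_w(s)².  Conversely Σ_w Σₛ r_w(s)² counts pairs of pairs that
-- collide at w, and two pairs with x ≠ x′ collide only on an affine hyperplane of p^(n−1) vectors w,
-- whence p Σ_w Σₛ r_w(s)² ≤ N p^(n+1) + N² pⁿ.  Comparing the two estimates gives
-- |Z|² |A| |C| ≤ p^(n+2).

module Submission where

open import Defs
open import Data.Bool using (if_then_else_)
open import Data.Empty using (⊥-elim)
open import Data.Fin using (Fin; toℕ; zero; suc)
import Data.Fin.Properties as Fin
open import Data.Fin.Properties using (all?)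
open import Data.Fin.Subset using (Subset; Nonempty; ∣_∣; _∩_; _∈_; inside; outside)
open import Data.Fin.Subset.Properties using (_∈?_; x∈p∩q⁻)
open import Data.List using (List; []; _∷_; map; concatMap; _++_; allFin; length)
open import Data.List.Properties using (map-tabulate; length-tabulate)
open import Data.Nat
  using (ℕ; NonZero; >-nonZero⁻¹; zero; suc; _+_; _*_; _∸_; _^_; _≤_; _<_; _>_; z≤n; s≤s; _<?_)
open import Data.Nat.DivMod
  using (_mod_; _%_; _/_; m%n<n; m%n≤n; m%n%n≡m%n; m≡m%n+[m/n]*n; [m+kn]%n≡m%n; [m+n]%n≡m%n;
         %-distribˡ-+; m<n⇒m%n≡m)
open import Data.Nat.Divisibility using (_∣_; ∣⇒≤; m%n≡0⇒n∣m)
open import Data.Nat.Primality using (Prime; prime⇒nonZero; euclidsLemma)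
open import Data.Nat.Properties hiding (_≟_)
open import Data.Nat.Tactic.RingSolver using (solve-∀)
open import Algebra.Properties.CommutativeSemigroup +-commutativeSemigroup
  using () renaming (interchange to +-interchange; xy∙z≈xz∙y to +-right-comm; x∙yz≈y∙xz to +-x∙yz≈y∙xz)
open import Algebra.Properties.CommutativeSemigroup *-commutativeSemigroup
  using () renaming (interchange to *-interchange; x∙yz≈y∙xz to *-x∙yz≈y∙xz)
open import Data.Product using (Σ; ∃; _×_; _,_; proj₁; proj₂)
open import Data.Sum using (inj₁; inj₂; [_,_]′)
open import Data.Vec using (Vec; []; _∷_; lookup; zipWith)
import Data.Vec.Properties as Vec
open import Function using (_∘_; id)
open import Relation.Binary.Definitions using (DecidableEquality; Tri; tri<; tri≈; tri>)
open import Relation.Binary.PropositionalEquality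
open import Relation.Nullary using (Dec; yes; no; does; ¬_; _×-dec_)
open import Relation.Unary using (Decidable)

private
  variable
    A B P Q : Set

-- Finite sums and the Cauchy–Schwarz inequality

∑ₗ : List A → (A → ℕ) → ℕ
∑ₗ []       f = 0
∑ₗ (x ∷ xs) f = f x + ∑ₗ xs f

∑ₗ-cong : (L : List A) {f g : A → ℕ} → (∀ x → f x ≡ g x) → ∑ₗ L f ≡ ∑ₗ L g
∑ₗ-cong []       f≗g = refl
∑ₗ-cong (x ∷ xs) f≗g = cong₂ _+_ (f≗g x) (∑ₗ-cong xs f≗g)

∑ₗ-mono-≤ : (L : List A) {f g : A → ℕ} → (∀ x → f x ≤ g x) → ∑ₗ L f ≤ ∑ₗ L g
∑ₗ-mono-≤ []       f≤g = z≤n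
∑ₗ-mono-≤ (x ∷ xs) f≤g = +-mono-≤ (f≤g x) (∑ₗ-mono-≤ xs f≤g)

∑ₗ-distrib-+ : (L : List A) (f g : A → ℕ) → ∑ₗ L (λ x → f x + g x) ≡ ∑ₗ L f + ∑ₗ L g
∑ₗ-distrib-+ []       f g = refl
∑ₗ-distrib-+ (x ∷ xs) f g = begin
  f x + g x + ∑ₗ xs (λ x → f x + g x)  ≡⟨ cong (f x + g x +_) (∑ₗ-distrib-+ xs f g) ⟩
  f x + g x + (∑ₗ xs f + ∑ₗ xs g)      ≡⟨ +-interchange (f x) (g x) (∑ₗ xs f) (∑ₗ xs g) ⟩
  f x + ∑ₗ xs f + (g x + ∑ₗ xs g)      ∎
  where open ≡-Reasoning

∑ₗ-*ˡ : (L : List A) (c : ℕ) (f : A → ℕ) → ∑ₗ L (λ x → c * f x) ≡ c * ∑ₗ L f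
∑ₗ-*ˡ []       c f = sym (*-zeroʳ c)
∑ₗ-*ˡ (x ∷ xs) c f = trans (cong (c * f x +_) (∑ₗ-*ˡ xs c f)) (sym (*-distribˡ-+ c (f x) (∑ₗ xs f)))

∑ₗ-*ʳ : (L : List A) (c : ℕ) (f : A → ℕ) → ∑ₗ L (λ x → f x * c) ≡ ∑ₗ L f * c
∑ₗ-*ʳ L c f = trans (∑ₗ-cong L (λ x → *-comm (f x) c)) (trans (∑ₗ-*ˡ L c f) (*-comm c (∑ₗ L f)))

∑ₗ-const : (L : List A) (c : ℕ) → ∑ₗ L (λ _ → c) ≡ length L * c
∑ₗ-const []       c = refl
∑ₗ-const (x ∷ xs) c = cong (c +_) (∑ₗ-const xs c)

∑ₗ-zero : (L : List A) → ∑ₗ L (λ _ → 0) ≡ 0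
∑ₗ-zero L = trans (∑ₗ-const L 0) (*-zeroʳ (length L))

∑ₗ-comm : (L : List A) (M : List B) (f : A → B → ℕ) →
  ∑ₗ L (λ x → ∑ₗ M (f x)) ≡ ∑ₗ M (λ y → ∑ₗ L (λ x → f x y))
∑ₗ-comm []       M f = sym (∑ₗ-zero M)
∑ₗ-comm (x ∷ xs) M f = trans (cong (∑ₗ M (f x) +_) (∑ₗ-comm xs M f))
                             (sym (∑ₗ-distrib-+ M (f x) (λ y → ∑ₗ xs (λ x → f x y))))

∑ₗ-*-∑ₗ : (L : List A) (M : List B) (f : A → ℕ) (g : B → ℕ) →
  ∑ₗ L f * ∑ₗ M g ≡ ∑ₗ L (λ x → ∑ₗ M (λ y → f x * g y))
∑ₗ-*-∑ₗ L M f g = begin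
  ∑ₗ L f * ∑ₗ M g                       ≡⟨ sym (∑ₗ-*ʳ L (∑ₗ M g) f) ⟩
  ∑ₗ L (λ x → f x * ∑ₗ M g)             ≡⟨ ∑ₗ-cong L (λ x → sym (∑ₗ-*ˡ M (f x) g)) ⟩
  ∑ₗ L (λ x → ∑ₗ M (λ y → f x * g y))  ∎
  where open ≡-Reasoning

∑ₗ-map : (g : B → A) (L : List B) (f : A → ℕ) → ∑ₗ (map g L) f ≡ ∑ₗ L (f ∘ g)
∑ₗ-map g []       f = refl
∑ₗ-map g (x ∷ xs) f = cong (f (g x) +_) (∑ₗ-map g xs f)

∑ₗ-++ : (K M : List A) (f : A → ℕ) → ∑ₗ (K ++ M) f ≡ ∑ₗ K f + ∑ₗ M f
∑ₗ-++ []       M f = refl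
∑ₗ-++ (y ∷ ys) M f = trans (cong (f y +_) (∑ₗ-++ ys M f)) (sym (+-assoc (f y) _ _))

∑ₗ-concatMap : (g : B → List A) (L : List B) (f : A → ℕ) →
  ∑ₗ (concatMap g L) f ≡ ∑ₗ L (λ x → ∑ₗ (g x) f)
∑ₗ-concatMap g []       f = refl
∑ₗ-concatMap g (x ∷ xs) f =
  trans (∑ₗ-++ (g x) _ f) (cong (∑ₗ (g x) f +_) (∑ₗ-concatMap g xs f))

∑ₗ-positive : (L : List A) (f : A → ℕ) → 0 < ∑ₗ L f → ∃ λ x → 0 < f x
∑ₗ-positive []       f ()
∑ₗ-positive (x ∷ xs) f pos with f x in fx
... | suc _ = x , subst (0 <_) (sym fx) (s≤s z≤n)
... | zero  = ∑ₗ-positive xs f pos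

2*m*n≤m*m+n*n : ∀ m n → 2 * (m * n) ≤ m * m + n * n
2*m*n≤m*m+n*n m n = [ ordered , swapped ]′ (≤-total m n)
  where
  gap : ∀ m d → 2 * (m * (m + d)) ≤ m * m + (m + d) * (m + d)
  gap m d = subst (2 * (m * (m + d)) ≤_) (expand m d) (m≤m+n _ (d * d))
    where
    expand : ∀ m d → 2 * (m * (m + d)) + d * d ≡ m * m + (m + d) * (m + d)
    expand = solve-∀
  ordered : ∀ {m n} → m ≤ n → 2 * (m * n) ≤ m * m + n * n
  ordered {m} {n} m≤n = subst (λ k → 2 * (m * k) ≤ m * m + k * k) (m+[n∸m]≡n m≤n) (gap m (n ∸ m))
  swapped : n ≤ m → 2 * (m * n) ≤ m * m + n * n
  swapped n≤m = subst₂ _≤_ (cong (2 *_) (*-comm n m)) (+-comm (n * n) (m * m)) (ordered n≤m)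

m*n>0⇒m>0×n>0 : ∀ m n → 0 < m * n → 0 < m × 0 < n
m*n>0⇒m>0×n>0 (suc m) (suc n) _ = s≤s z≤n , s≤s z≤n
m*n>0⇒m>0×n>0 (suc m) zero    h = ⊥-elim (<-irrefl refl (subst (0 <_) (*-zeroʳ (suc m)) h))

*-cancel-square : ∀ a b N → a * (N * N) ≤ b * N → a * N ≤ b
*-cancel-square a b zero    _ = subst (_≤ b) (sym (*-zeroʳ a)) z≤n
*-cancel-square a b (suc N) h = *-cancelʳ-≤ (a * suc N) b (suc N) (subst (_≤ b * suc N) (sym (*-assoc a (suc N) (suc N))) h)

𝟙 : Dec P → ℕ
𝟙 d = if does d then 1 else 0

𝟙≤1 : (d : Dec P) → 𝟙 d ≤ 1
𝟙≤1 (yes _) = s≤s z≤n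
𝟙≤1 (no _)  = z≤n

𝟙-yes : (d : Dec P) → P → 𝟙 d ≡ 1
𝟙-yes (yes _) _ = refl
𝟙-yes (no ¬p) p = ⊥-elim (¬p p)

𝟙-no : (d : Dec P) → ¬ P → 𝟙 d ≡ 0
𝟙-no (yes p) ¬p = ⊥-elim (¬p p)
𝟙-no (no _)  _  = refl

𝟙>0⇒ : (d : Dec P) → 0 < 𝟙 d → P
𝟙>0⇒ (yes p) _ = p

𝟙-cong : (d : Dec P) (e : Dec Q) → (P → Q) → (Q → P) → 𝟙 d ≡ 𝟙 e
𝟙-cong d (yes q) _   Q→P = 𝟙-yes d (Q→P q)
𝟙-cong d (no ¬q) P→Q _   = 𝟙-no d (¬q ∘ P→Q)

𝟙-×-dec : (d : Dec P) (e : Dec Q) → 𝟙 (d ×-dec e) ≡ 𝟙 d * 𝟙 e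
𝟙-×-dec (yes _) e = sym (+-identityʳ (𝟙 e))
𝟙-×-dec (no _)  e = refl

𝟙*m≤m : (d : Dec P) (m : ℕ) → 𝟙 d * m ≤ m
𝟙*m≤m (yes _) m = ≤-reflexive (+-identityʳ m)
𝟙*m≤m (no _)  m = z≤n

𝟙*𝟙≡𝟙 : (d : Dec P) → 𝟙 d * 𝟙 d ≡ 𝟙 d
𝟙*𝟙≡𝟙 (yes _) = refl
𝟙*𝟙≡𝟙 (no _)  = refl

cauchy-schwarz : (L : List A) (f g : A → ℕ) →
  ∑ₗ L (λ x → f x * g x) * ∑ₗ L (λ x → f x * g x) ≤ ∑ₗ L (λ x → f x * f x) * ∑ₗ L (λ x → g x * g x)
cauchy-schwarz {A = A} L f g = *-cancelˡ-≤ 2 (begin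
  2 * (∑ₗ L fg * ∑ₗ L fg)                                    ≡⟨ cong (2 *_) (∑ₗ-*-∑ₗ L L fg fg) ⟩
  2 * ∑ₗ L (λ x → ∑ₗ L (λ y → fg x * fg y))                 ≡⟨ double-∑ₗ-*ˡ ⟩
  ∑ₗ L (λ x → ∑ₗ L (λ y → 2 * (fg x * fg y)))              ≤⟨ ∑ₗ-mono-≤ L (λ x → ∑ₗ-mono-≤ L (λ y → am-gm x y)) ⟩
  ∑ₗ L (λ x → ∑ₗ L (λ y → u x y * u x y + u y x * u y x))  ≡⟨ split ⟩
  U + ∑ₗ L (λ x → ∑ₗ L (λ y → u y x * u y x))              ≡⟨ cong (U +_) (∑ₗ-comm L L (λ x y → u y x * u y x)) ⟩
  U + U                                                     ≡⟨ cong (U +_) (sym (+-identityʳ U)) ⟩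
  2 * U                                                     ≡⟨ cong (2 *_) U≡∑f²*∑g² ⟩
  2 * (∑ₗ L (λ x → f x * f x) * ∑ₗ L (λ x → g x * g x))     ∎)
  where
  open ≤-Reasoning
  fg : A → ℕ
  fg x = f x * g x
  u : A → A → ℕ
  u x y = f x * g y
  U : ℕ
  U = ∑ₗ L (λ x → ∑ₗ L (λ y → u x y * u x y))
  double-∑ₗ-*ˡ : 2 * ∑ₗ L (λ x → ∑ₗ L (λ y → fg x * fg y)) ≡ ∑ₗ L (λ x → ∑ₗ L (λ y → 2 * (fg x * fg y)))
  double-∑ₗ-*ˡ = trans (sym (∑ₗ-*ˡ L 2 _)) (∑ₗ-cong L (λ x → sym (∑ₗ-*ˡ L 2 _)))
  am-gm : ∀ x y → 2 * (fg x * fg y) ≤ u x y * u x y + u y x * u y x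
  am-gm x y = subst (λ k → 2 * k ≤ u x y * u x y + u y x * u y x)
    (rearrange (f x) (g x) (f y) (g y)) (2*m*n≤m*m+n*n (u x y) (u y x))
    where
    rearrange : ∀ a b c d → (a * d) * (c * b) ≡ (a * b) * (c * d)
    rearrange = solve-∀
  split : ∑ₗ L (λ x → ∑ₗ L (λ y → u x y * u x y + u y x * u y x))
        ≡ U + ∑ₗ L (λ x → ∑ₗ L (λ y → u y x * u y x))
  split = trans (∑ₗ-cong L (λ x → ∑ₗ-distrib-+ L _ _)) (∑ₗ-distrib-+ L _ _)
  U≡∑f²*∑g² : U ≡ ∑ₗ L (λ x → f x * f x) * ∑ₗ L (λ x → g x * g x)
  U≡∑f²*∑g² = trans (∑ₗ-cong L (λ x → ∑ₗ-cong L (λ y → rearrange (f x) (g y))))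
                    (sym (∑ₗ-*-∑ₗ L L _ _))
    where
    rearrange : ∀ a b → (a * b) * (a * b) ≡ (a * a) * (b * b)
    rearrange = solve-∀

m*𝟙[0<m]≡m : ∀ m → m * 𝟙 (0 <? m) ≡ m
m*𝟙[0<m]≡m zero    = refl
m*𝟙[0<m]≡m (suc m) = *-identityʳ (suc m)

cauchy-schwarz-support : (L : List A) (f : A → ℕ) →
  ∑ₗ L f * ∑ₗ L f ≤ ∑ₗ L (λ x → 𝟙 (0 <? f x)) * ∑ₗ L (λ x → f x * f x)
cauchy-schwarz-support {A = A} L f = begin
  ∑ₗ L f * ∑ₗ L f                                   ≡⟨ sym (cong₂ _*_ ∑fχ≡∑f ∑fχ≡∑f) ⟩
  ∑ₗ L (λ x → f x * χ x) * ∑ₗ L (λ x → f x * χ x)  ≤⟨ cauchy-schwarz L f χ ⟩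
  ∑ₗ L (λ x → f x * f x) * ∑ₗ L (λ x → χ x * χ x)  ≡⟨ cong (∑ₗ L (λ x → f x * f x) *_) ∑χχ≡∑χ ⟩
  ∑ₗ L (λ x → f x * f x) * ∑ₗ L χ                  ≡⟨ *-comm _ (∑ₗ L χ) ⟩
  ∑ₗ L χ * ∑ₗ L (λ x → f x * f x)                  ∎
  where
  χ : A → ℕ
  χ x = 𝟙 (0 <? f x)
  open ≤-Reasoning
  ∑fχ≡∑f : ∑ₗ L (λ x → f x * χ x) ≡ ∑ₗ L f
  ∑fχ≡∑f = ∑ₗ-cong L (λ x → m*𝟙[0<m]≡m (f x))
  ∑χχ≡∑χ : ∑ₗ L (λ x → χ x * χ x) ≡ ∑ₗ L χ
  ∑χχ≡∑χ = ∑ₗ-cong L (λ x → 𝟙*𝟙≡𝟙 (0 <? f x))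

-- Enumerated finite types

record Enumeration (A : Set) : Set where
  field
    elements    : List A
    _≟_         : DecidableEquality A
    listed-once : ∀ a → ∑ₗ elements (λ x → 𝟙 (a ≟ x)) ≡ 1

  δ : A → A → ℕ
  δ a x = 𝟙 (a ≟ x)

  ∑ₗ-δ : (a : A) (f : A → ℕ) → ∑ₗ elements (λ x → f x * δ a x) ≡ f a
  ∑ₗ-δ a f = begin
    ∑ₗ elements (λ x → f x * δ a x)  ≡⟨ ∑ₗ-cong elements f≡fa-on-a ⟩
    ∑ₗ elements (λ x → f a * δ a x)  ≡⟨ ∑ₗ-*ˡ elements (f a) (δ a) ⟩
    f a * ∑ₗ elements (δ a)          ≡⟨ cong (f a *_) (listed-once a) ⟩
    f a * 1                          ≡⟨ *-identityʳ (f a) ⟩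
    f a                              ∎
    where
    open ≡-Reasoning
    f≡fa-on-a : ∀ x → f x * δ a x ≡ f a * δ a x
    f≡fa-on-a x with a ≟ x
    ... | yes refl = refl
    ... | no _     = trans (*-zeroʳ (f x)) (sym (*-zeroʳ (f a)))

  ≤-∑ₗ : (a : A) (f : A → ℕ) → f a ≤ ∑ₗ elements f
  ≤-∑ₗ a f = subst (_≤ ∑ₗ elements f) (∑ₗ-δ a f) (∑ₗ-mono-≤ elements (λ x →
    subst (f x * δ a x ≤_) (*-identityʳ (f x)) (*-monoʳ-≤ (f x) (𝟙≤1 (a ≟ x)))))

  ∑ₗ≡0⇒≡0 : (f : A → ℕ) → ∑ₗ elements f ≡ 0 → ∀ a → f a ≡ 0
  ∑ₗ≡0⇒≡0 f ∑f≡0 a = n≤0⇒n≡0 (subst (f a ≤_) ∑f≡0 (≤-∑ₗ a f))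

  ∑ₗ-𝟙≤1 : {R : A → Set} (R? : Decidable R) → (∀ x y → R x → R y → x ≡ y) →
    ∑ₗ elements (λ x → 𝟙 (R? x)) ≤ 1
  ∑ₗ-𝟙≤1 R? unique with 0 <? ∑ₗ elements (λ x → 𝟙 (R? x))
  ... | no ∑≯0 = ≤-trans (≮⇒≥ ∑≯0) z≤n
  ... | yes ∑>0 with ∑ₗ-positive elements (λ x → 𝟙 (R? x)) ∑>0
  ... | a , 𝟙Ra>0 = subst (∑ₗ elements (λ x → 𝟙 (R? x)) ≤_) (listed-once a) (∑ₗ-mono-≤ elements below-δ)
    where
    below-δ : ∀ x → 𝟙 (R? x) ≤ δ a x
    below-δ x with R? x
    ... | no _   = z≤n
    ... | yes Rx = ≤-reflexive (sym (𝟙-yes (a ≟ x) (unique a x (𝟙>0⇒ (R? a) 𝟙Ra>0) Rx)))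

  ∑ₗ-pairs-δ : {R : A → Set} (R? : Decidable R) (u v : ℕ) →
    let ∣R∣ = ∑ₗ elements (λ x → 𝟙 (R? x)) in
    ∑ₗ elements (λ x → ∑ₗ elements (λ y → 𝟙 (R? x) * 𝟙 (R? y) * (δ x y * u + v)))
      ≡ ∣R∣ * u + ∣R∣ * (∣R∣ * v)
  ∑ₗ-pairs-δ R? u v = begin
    ∑ₗ elements (λ x → ∑ₗ elements (λ y → χ x * χ y * (δ x y * u + v)))
      ≡⟨ ∑ₗ-cong elements (λ x → ∑ₗ-cong elements (λ y → expand (χ x) (χ y) (δ x y) u v)) ⟩
    ∑ₗ elements (λ x → ∑ₗ elements (λ y → χ x * χ y * u * δ x y + χ x * (χ y * v)))
      ≡⟨ ∑ₗ-cong elements (λ x → ∑ₗ-distrib-+ elements _ _) ⟩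
    ∑ₗ elements (λ x → ∑ₗ elements (λ y → χ x * χ y * u * δ x y) + ∑ₗ elements (λ y → χ x * (χ y * v)))
      ≡⟨ ∑ₗ-cong elements (λ x → cong₂ _+_ (∑ₗ-δ x (λ y → χ x * χ y * u))
                                            (trans (∑ₗ-*ˡ elements (χ x) _) (cong (χ x *_) (∑ₗ-*ʳ elements v χ)))) ⟩
    ∑ₗ elements (λ x → χ x * χ x * u + χ x * (∣R∣ * v))
      ≡⟨ ∑ₗ-cong elements (λ x → cong (λ k → k * u + χ x * (∣R∣ * v)) (𝟙*𝟙≡𝟙 (R? x))) ⟩
    ∑ₗ elements (λ x → χ x * u + χ x * (∣R∣ * v))
      ≡⟨ ∑ₗ-distrib-+ elements _ _ ⟩
    ∑ₗ elements (λ x → χ x * u) + ∑ₗ elements (λ x → χ x * (∣R∣ * v))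
      ≡⟨ cong₂ _+_ (∑ₗ-*ʳ elements u χ) (∑ₗ-*ʳ elements (∣R∣ * v) χ) ⟩
    ∣R∣ * u + ∣R∣ * (∣R∣ * v) ∎
    where
    open ≡-Reasoning
    χ : A → ℕ
    χ x = 𝟙 (R? x)
    ∣R∣ : ℕ
    ∣R∣ = ∑ₗ elements χ
    expand : ∀ a b d u v → a * b * (d * u + v) ≡ a * b * u * d + a * (b * v)
    expand = solve-∀

open Enumeration using (elements; listed-once)

∑ₗ-allFin : ∀ n (f : Fin (suc n) → ℕ) → ∑ₗ (allFin (suc n)) f ≡ f zero + ∑ₗ (allFin n) (f ∘ suc)
∑ₗ-allFin n f = cong (f zero +_)
  (trans (cong (λ L → ∑ₗ L f) (sym (map-tabulate id suc))) (∑ₗ-map suc (allFin n) f))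

∑ₗ-allFin-const : ∀ n c → ∑ₗ (allFin n) (λ _ → c) ≡ n * c
∑ₗ-allFin-const n c = trans (∑ₗ-const (allFin n) c) (cong (_* c) (length-tabulate {n = n} id))

Fin-enumeration : (n : ℕ) → Enumeration (Fin n)
Fin-enumeration n = record { elements = allFin n ; _≟_ = Fin._≟_ ; listed-once = once n }
  where
  once : ∀ n (a : Fin n) → ∑ₗ (allFin n) (λ x → 𝟙 (a Fin.≟ x)) ≡ 1
  once (suc n) zero    = trans (∑ₗ-allFin n (λ x → 𝟙 (zero Fin.≟ x))) (cong suc (∑ₗ-zero (allFin n)))
  once (suc n) (suc a) = trans (∑ₗ-allFin n (λ x → 𝟙 (suc a Fin.≟ x))) (once n a)

vectors : List A → (m : ℕ) → List (Vec A m)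
vectors xs zero    = [] ∷ []
vectors xs (suc m) = concatMap (λ a → map (a ∷_) (vectors xs m)) xs

∑ₗ-vectors : (xs : List A) (m : ℕ) (f : Vec A (suc m) → ℕ) →
  ∑ₗ (vectors xs (suc m)) f ≡ ∑ₗ xs (λ a → ∑ₗ (vectors xs m) (λ v → f (a ∷ v)))
∑ₗ-vectors xs m f =
  trans (∑ₗ-concatMap _ xs f) (∑ₗ-cong xs (λ a → ∑ₗ-map (a ∷_) (vectors xs m) f))

∑ₗ-vectors-const : (xs : List A) (m c : ℕ) → ∑ₗ (vectors xs m) (λ _ → c) ≡ length xs ^ m * c
∑ₗ-vectors-const xs zero    c = refl
∑ₗ-vectors-const xs (suc m) c = begin
  ∑ₗ (vectors xs (suc m)) (λ _ → c)              ≡⟨ ∑ₗ-vectors xs m _ ⟩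
  ∑ₗ xs (λ _ → ∑ₗ (vectors xs m) (λ _ → c))      ≡⟨ ∑ₗ-cong xs (λ _ → ∑ₗ-vectors-const xs m c) ⟩
  ∑ₗ xs (λ _ → length xs ^ m * c)                ≡⟨ ∑ₗ-const xs _ ⟩
  length xs * (length xs ^ m * c)                ≡⟨ sym (*-assoc (length xs) _ c) ⟩
  length xs ^ suc m * c                          ∎
  where open ≡-Reasoning

∑ₗ-vectors-∏ : (xs : List A) (m : ℕ) (g : Fin m → A → ℕ) →
  ∑ₗ (vectors xs m) (λ v → ∏ m (λ i → g i (lookup v i))) ≡ ∏ m (λ i → ∑ₗ xs (g i))
∑ₗ-vectors-∏ xs zero    g = refl
∑ₗ-vectors-∏ {A = A} xs (suc m) g = begin
  ∑ₗ (vectors xs (suc m)) (λ v → ∏ (suc m) (λ i → g i (lookup v i)))   ≡⟨ ∑ₗ-vectors xs m _ ⟩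
  ∑ₗ xs (λ a → ∑ₗ (vectors xs m) (λ v → g zero a * rest v))            ≡⟨ ∑ₗ-cong xs (λ a → ∑ₗ-*ˡ (vectors xs m) (g zero a) rest) ⟩
  ∑ₗ xs (λ a → g zero a * ∑ₗ (vectors xs m) rest)                      ≡⟨ ∑ₗ-*ʳ xs _ (g zero) ⟩
  ∑ₗ xs (g zero) * ∑ₗ (vectors xs m) rest                              ≡⟨ cong (∑ₗ xs (g zero) *_) (∑ₗ-vectors-∏ xs m (g ∘ suc)) ⟩
  ∏ (suc m) (λ i → ∑ₗ xs (g i))                                        ∎
  where
  open ≡-Reasoning
  rest : Vec A m → ℕ
  rest v = ∏ m (λ i → g (suc i) (lookup v i))

Vec-enumeration : Enumeration A → (m : ℕ) → Enumeration (Vec A m)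
Vec-enumeration {A = A} E m =
  record { elements = vectors es m ; _≟_ = Vec.≡-dec _≟_ ; listed-once = once m }
  where
  open Enumeration E using (_≟_; δ) renaming (elements to es)
  δᵛ : ∀ {k} → Vec A k → Vec A k → ℕ
  δᵛ u v = 𝟙 (Vec.≡-dec _≟_ u v)
  once : ∀ m (a : Vec A m) → ∑ₗ (vectors es m) (δᵛ a) ≡ 1
  once zero    []       = refl
  once (suc m) (a ∷ as) = begin
    ∑ₗ (vectors es (suc m)) (δᵛ (a ∷ as))
      ≡⟨ ∑ₗ-vectors es m _ ⟩
    ∑ₗ es (λ x → ∑ₗ (vectors es m) (λ xs → δᵛ (a ∷ as) (x ∷ xs)))
      ≡⟨ ∑ₗ-cong es (λ x → ∑ₗ-cong (vectors es m) (λ xs → 𝟙-×-dec (a ≟ x) (Vec.≡-dec _≟_ as xs))) ⟩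
    ∑ₗ es (λ x → ∑ₗ (vectors es m) (λ xs → δ a x * δᵛ as xs))
      ≡⟨ ∑ₗ-cong es (λ x → ∑ₗ-*ˡ (vectors es m) (δ a x) (δᵛ as)) ⟩
    ∑ₗ es (λ x → δ a x * ∑ₗ (vectors es m) (δᵛ as))
      ≡⟨ ∑ₗ-cong es (λ x → trans (cong (δ a x *_) (once m as)) (*-identityʳ (δ a x))) ⟩
    ∑ₗ es (δ a)
      ≡⟨ listed-once E a ⟩
    1 ∎
    where open ≡-Reasoning

∣S∣≡∑𝟙∈ : ∀ {m} (S : Subset m) → ∣ S ∣ ≡ ∑ₗ (allFin m) (λ t → 𝟙 (t ∈? S))
∣S∣≡∑𝟙∈ []            = refl
∣S∣≡∑𝟙∈ (inside ∷ S)  = trans (cong suc (∣S∣≡∑𝟙∈ S)) (sym (∑ₗ-allFin _ (λ t → 𝟙 (t ∈? inside ∷ S))))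
∣S∣≡∑𝟙∈ (outside ∷ S) = trans (∣S∣≡∑𝟙∈ S) (sym (∑ₗ-allFin _ (λ t → 𝟙 (t ∈? outside ∷ S))))

∏-cong : ∀ m {f g : Fin m → ℕ} → (∀ i → f i ≡ g i) → ∏ m f ≡ ∏ m g
∏-cong zero    f≗g = refl
∏-cong (suc m) f≗g = cong₂ _*_ (f≗g zero) (∏-cong m (f≗g ∘ suc))

∏-distrib-* : ∀ m (f g : Fin m → ℕ) → ∏ m (λ i → f i * g i) ≡ ∏ m f * ∏ m g
∏-distrib-* zero    f g = refl
∏-distrib-* (suc m) f g = trans (cong (f zero * g zero *_) (∏-distrib-* m (f ∘ suc) (g ∘ suc)))
  (*-interchange (f zero) (g zero) (∏ m (f ∘ suc)) (∏ m (g ∘ suc)))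

𝟙-all? : ∀ {m} {R : Fin m → Set} (R? : Decidable R) → 𝟙 (all? R?) ≡ ∏ m (λ i → 𝟙 (R? i))
𝟙-all? {zero}  R? = 𝟙-yes (all? R?) (λ ())
𝟙-all? {suc m} {R} R? = begin
  𝟙 (all? R?)                         ≡⟨ 𝟙-cong (all? R?) (R? zero ×-dec all? (R? ∘ suc)) split join ⟩
  𝟙 (R? zero ×-dec all? (R? ∘ suc))   ≡⟨ 𝟙-×-dec (R? zero) (all? (R? ∘ suc)) ⟩
  𝟙 (R? zero) * 𝟙 (all? (R? ∘ suc))   ≡⟨ cong (𝟙 (R? zero) *_) (𝟙-all? (R? ∘ suc)) ⟩
  ∏ (suc m) (λ i → 𝟙 (R? i))          ∎
  where
  open ≡-Reasoning
  split : (∀ i → R i) → R zero × (∀ i → R (suc i))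
  split all = all zero , all ∘ suc
  join : R zero × (∀ i → R (suc i)) → ∀ i → R i
  join (r₀ , rs) zero    = r₀
  join (r₀ , rs) (suc i) = rs i

∑ₗ-allFin-𝟙≤n : ∀ n {R : Fin n → Set} (R? : Decidable R) → ∑ₗ (allFin n) (λ t → 𝟙 (R? t)) ≤ n
∑ₗ-allFin-𝟙≤n n R? = ≤-trans (∑ₗ-mono-≤ (allFin n) (λ t → 𝟙≤1 (R? t)))
                             (≤-reflexive (trans (∑ₗ-allFin-const n 1) (*-identityʳ n)))

∑ₗ-Finⁿ-const : ∀ n m c → ∑ₗ (vectors (allFin n) m) (λ _ → c) ≡ n ^ m * c
∑ₗ-Finⁿ-const n m c =
  trans (∑ₗ-vectors-const (allFin n) m c) (cong (λ k → k ^ m * c) (length-tabulate {n = n} id))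

-- Arithmetic modulo a prime

module Modular (p : ℕ) (pr : Prime p) where

  private
    instance
      p≢0 : NonZero p
      p≢0 = prime⇒nonZero pr

  toℕ-mod : ∀ m → toℕ (m mod p) ≡ m % p
  toℕ-mod m = Fin.toℕ-fromℕ< (m%n<n m p)

  mod≡⇒%≡ : ∀ m k → m mod p ≡ k mod p → m % p ≡ k % p
  mod≡⇒%≡ m k eq = trans (sym (toℕ-mod m)) (trans (cong toℕ eq) (toℕ-mod k))

  %≡⇒mod≡ : ∀ m k → m % p ≡ k % p → m mod p ≡ k mod p
  %≡⇒mod≡ m k eq = Fin.toℕ-injective (trans (toℕ-mod m) (trans eq (sym (toℕ-mod k))))

  toℕ-%-injective : (x y : Fin p) → toℕ x % p ≡ toℕ y % p → x ≡ y
  toℕ-%-injective x y eq = Fin.toℕ-injective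
    (trans (sym (m<n⇒m%n≡m (Fin.toℕ<n x))) (trans eq (m<n⇒m%n≡m (Fin.toℕ<n y))))

  %-congˡ-+ : ∀ {m k} c → m % p ≡ k % p → (m + c) % p ≡ (k + c) % p
  %-congˡ-+ {m} {k} c eq = begin
    (m + c) % p              ≡⟨ %-distribˡ-+ m c p ⟩
    (m % p + c % p) % p      ≡⟨ cong (λ r → (r + c % p) % p) eq ⟩
    (k % p + c % p) % p      ≡⟨ %-distribˡ-+ k c p ⟨
    (k + c) % p              ∎
    where open ≡-Reasoning

  %-absorbˡ-+ : ∀ m c → (m % p + c) % p ≡ (m + c) % p
  %-absorbˡ-+ m c = %-congˡ-+ c (m%n%n≡m%n m p)

  +-complement : ∀ m c → (m + c + (p ∸ c % p)) % p ≡ m % p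
  +-complement m c = trans (cong (_% p) regroup) ([m+kn]%n≡m%n m (suc (c / p)) p)
    where
    open ≡-Reasoning
    r : ℕ
    r = c % p
    regroup : m + c + (p ∸ r) ≡ m + suc (c / p) * p
    regroup = begin
      m + c + (p ∸ r)                    ≡⟨ cong (λ c → m + c + (p ∸ r)) (m≡m%n+[m/n]*n c p) ⟩
      m + (r + c / p * p) + (p ∸ r)      ≡⟨ shuffle m r (c / p * p) (p ∸ r) ⟩
      m + (r + (p ∸ r)) + c / p * p      ≡⟨ cong (λ k → m + k + c / p * p) (m+[n∸m]≡n (m%n≤n c p)) ⟩
      m + p + c / p * p                  ≡⟨ +-assoc m p (c / p * p) ⟩
      m + suc (c / p) * p                ∎
      where
      shuffle : ∀ a b c d → a + (b + c) + d ≡ a + (b + d) + c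
      shuffle = solve-∀

  %-cancelʳ-+ : ∀ m k c → (m + c) % p ≡ (k + c) % p → m % p ≡ k % p
  %-cancelʳ-+ m k c eq = begin
    m % p                          ≡⟨ +-complement m c ⟨
    (m + c + (p ∸ c % p)) % p      ≡⟨ %-congˡ-+ (p ∸ c % p) eq ⟩
    (k + c + (p ∸ c % p)) % p      ≡⟨ +-complement k c ⟩
    k % p                          ∎
    where open ≡-Reasoning

  multiple-of-p<p : ∀ {e} → e < p → p ∣ e → e ≡ 0
  multiple-of-p<p {zero}  _   _   = refl
  multiple-of-p<p {suc e} e<p p∣e = ⊥-elim (<⇒≱ e<p (∣⇒≤ p∣e))

  *-cancelˡ-%-≥ : ∀ {d w w′} → 0 < d → d < p → w′ ≤ w → w < p →
    (d * w) % p ≡ (d * w′) % p → w ≡ w′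
  *-cancelˡ-%-≥ {d} {w} {w′} 0<d d<p w′≤w w<p eq
    with euclidsLemma d (w ∸ w′) pr (m%n≡0⇒n∣m _ p d[w∸w′]%p≡0)
    where
    d[w∸w′]%p≡0 : (d * (w ∸ w′)) % p ≡ 0
    d[w∸w′]%p≡0 = trans (%-cancelʳ-+ (d * (w ∸ w′)) 0 (d * w′) (begin
      (d * (w ∸ w′) + d * w′) % p  ≡⟨ cong (_% p) (sym (*-distribˡ-+ d (w ∸ w′) w′)) ⟩
      (d * (w ∸ w′ + w′)) % p      ≡⟨ cong (λ k → (d * k) % p) (m∸n+n≡m w′≤w) ⟩
      (d * w) % p                  ≡⟨ eq ⟩
      (d * w′) % p                 ∎)) (m<n⇒m%n≡m (>-nonZero⁻¹ p))
      where open ≡-Reasoning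
  ... | inj₁ p∣d    = ⊥-elim (<⇒≢ 0<d (sym (multiple-of-p<p d<p p∣d)))
  ... | inj₂ p∣w∸w′ = ≤-antisym
    (m∸n≡0⇒m≤n (multiple-of-p<p (≤-<-trans (m∸n≤m w w′) w<p) p∣w∸w′)) w′≤w

  *-cancelˡ-% : ∀ {d w w′} → 0 < d → d < p → w < p → w′ < p →
    (d * w) % p ≡ (d * w′) % p → w ≡ w′
  *-cancelˡ-% {w = w} {w′} 0<d d<p w<p w′<p eq with ≤-total w′ w
  ... | inj₁ w′≤w = *-cancelˡ-%-≥ 0<d d<p w′≤w w<p eq
  ... | inj₂ w≤w′ = sym (*-cancelˡ-%-≥ 0<d d<p w≤w′ w′<p (sym eq))

  translate-once : ∀ K (z : Fin p) → ∑ₗ (allFin p) (λ t → 𝟙 ((toℕ t + K) mod p Fin.≟ z)) ≡ 1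
  translate-once K z = trans (∑ₗ-cong (allFin p) (λ t → 𝟙-cong ((toℕ t + K) mod p Fin.≟ z) (t₀ Fin.≟ t) (solution-is-t₀ t) (t₀-solves t)))
                             (listed-once (Fin-enumeration p) t₀)
    where
    t₀ : Fin p
    t₀ = (toℕ z + (p ∸ K % p)) mod p
    t₀+K≡z : (toℕ t₀ + K) % p ≡ toℕ z
    t₀+K≡z = begin
      (toℕ t₀ + K) % p                    ≡⟨ cong (λ r → (r + K) % p) (toℕ-mod _) ⟩
      ((toℕ z + (p ∸ K % p)) % p + K) % p ≡⟨ %-absorbˡ-+ _ K ⟩
      (toℕ z + (p ∸ K % p) + K) % p       ≡⟨ cong (_% p) (+-right-comm (toℕ z) _ K) ⟩
      (toℕ z + K + (p ∸ K % p)) % p       ≡⟨ +-complement (toℕ z) K ⟩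
      toℕ z % p                           ≡⟨ m<n⇒m%n≡m (Fin.toℕ<n z) ⟩
      toℕ z                               ∎
      where open ≡-Reasoning
    solution-is-t₀ : ∀ t → (toℕ t + K) mod p ≡ z → t₀ ≡ t
    solution-is-t₀ t t+K≡z = toℕ-%-injective t₀ t (%-cancelʳ-+ (toℕ t₀) (toℕ t) K
      (trans t₀+K≡z (sym (trans (sym (toℕ-mod _)) (cong toℕ t+K≡z)))))
    t₀-solves : ∀ t → t₀ ≡ t → (toℕ t + K) mod p ≡ z
    t₀-solves t refl = Fin.toℕ-injective (trans (toℕ-mod _) t₀+K≡z)

  affine-unique-< : ∀ k k′ {a a′ w w′} → a′ < a → a < p → w < p → w′ < p →
    (k + a * w) % p ≡ (k′ + a′ * w) % p → (k + a * w′) % p ≡ (k′ + a′ * w′) % p → w ≡ w′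
  affine-unique-< k k′ {a} {a′} {w} {w′} a′<a a<p w<p w′<p eq eq′ =
    *-cancelˡ-% (m<n⇒0<n∸m a′<a) (≤-<-trans (m∸n≤m a a′) a<p) w<p w′<p
      (%-cancelʳ-+ (d * w) (d * w′) k (begin
        (d * w + k) % p   ≡⟨ cong (_% p) (+-comm (d * w) k) ⟩
        (k + d * w) % p   ≡⟨ slope-part eq ⟩
        k′ % p            ≡⟨ slope-part eq′ ⟨
        (k + d * w′) % p  ≡⟨ cong (_% p) (+-comm k (d * w′)) ⟩
        (d * w′ + k) % p  ∎))
    where
    open ≡-Reasoning
    d : ℕ
    d = a ∸ a′
    slope-part : ∀ {v} → (k + a * v) % p ≡ (k′ + a′ * v) % p → (k + d * v) % p ≡ k′ % p
    slope-part {v} eq = %-cancelʳ-+ (k + d * v) k′ (a′ * v) (begin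
      (k + d * v + a′ * v) % p   ≡⟨ cong (_% p) (+-assoc k (d * v) (a′ * v)) ⟩
      (k + (d * v + a′ * v)) % p ≡⟨ cong (λ u → (k + u) % p) (sym (*-distribʳ-+ v d a′)) ⟩
      (k + (d + a′) * v) % p     ≡⟨ cong (λ u → (k + u * v) % p) (m∸n+n≡m (<⇒≤ a′<a)) ⟩
      (k + a * v) % p            ≡⟨ eq ⟩
      (k′ + a′ * v) % p          ∎)

  affine-unique : ∀ k k′ {a a′ w w′ : Fin p} → a ≢ a′ →
    (k + toℕ a * toℕ w) % p ≡ (k′ + toℕ a′ * toℕ w) % p →
    (k + toℕ a * toℕ w′) % p ≡ (k′ + toℕ a′ * toℕ w′) % p → w ≡ w′
  affine-unique k k′ {a} {a′} {w} {w′} a≢a′ eq eq′ =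
    Fin.toℕ-injective (by-order (<-cmp (toℕ a) (toℕ a′)))
    where
    by-order : Tri (toℕ a < toℕ a′) (toℕ a ≡ toℕ a′) (toℕ a > toℕ a′) → toℕ w ≡ toℕ w′
    by-order (tri< a<a′ _ _) = affine-unique-< k′ k a<a′ (Fin.toℕ<n a′) (Fin.toℕ<n w) (Fin.toℕ<n w′) (sym eq) (sym eq′)
    by-order (tri≈ _ a≡a′ _) = ⊥-elim (a≢a′ (Fin.toℕ-injective a≡a′))
    by-order (tri> _ _ a′<a) = affine-unique-< k k′ a′<a (Fin.toℕ<n a) (Fin.toℕ<n w) (Fin.toℕ<n w′) eq eq′

  ⟨_,_⟩ : ∀ {m} → Vec (Fin p) m → Vec (Fin p) m → ℕ
  ⟨_,_⟩ {m} = Heis.inner p pr m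

  𝔽ₚ : List (Fin p)
  𝔽ₚ = allFin p

  𝔽ₚ^ : (m : ℕ) → List (Vec (Fin p) m)
  𝔽ₚ^ = vectors 𝔽ₚ

  on-hyperplane : ∀ {m} (x x′ : Vec (Fin p) m) (k k′ : ℕ) → Vec (Fin p) m → ℕ
  on-hyperplane x x′ k k′ w = 𝟙 ((k + ⟨ x , w ⟩) mod p Fin.≟ (k′ + ⟨ x′ , w ⟩) mod p)

  hyperplane-bound : ∀ {m} (x x′ : Vec (Fin p) m) (k k′ : ℕ) → x ≢ x′ →
    p * ∑ₗ (𝔽ₚ^ m) (on-hyperplane x x′ k k′) ≤ p ^ m
  hyperplane-bound []      []        k k′ x≢x′    = ⊥-elim (x≢x′ refl)
  hyperplane-bound {suc m} (a ∷ x) (a′ ∷ x′) k k′ ax≢a′x′ = begin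
    p * ∑ₗ (𝔽ₚ^ (suc m)) (on-hyperplane (a ∷ x) (a′ ∷ x′) k k′)   ≡⟨ cong (p *_) (∑ₗ-vectors 𝔽ₚ m _) ⟩
    p * ∑ₗ 𝔽ₚ (λ w₀ → ∑ₗ (𝔽ₚ^ m) (λ w → on-hyperplane (a ∷ x) (a′ ∷ x′) k k′ (w₀ ∷ w)))
                                                                  ≡⟨ cong (p *_) (∑ₗ-cong 𝔽ₚ (λ w₀ → ∑ₗ-cong (𝔽ₚ^ m) (regroup w₀))) ⟩
    p * ∑ₗ 𝔽ₚ (λ w₀ → ∑ₗ (𝔽ₚ^ m) (on-hyperplane x x′ (k + toℕ a * toℕ w₀) (k′ + toℕ a′ * toℕ w₀)))
                                                                  ≤⟨ by-tails (Vec.≡-dec Fin._≟_ x x′) ⟩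
    p * p ^ m                                                     ∎
    where
    open ≤-Reasoning
    regroup : ∀ w₀ w → on-hyperplane (a ∷ x) (a′ ∷ x′) k k′ (w₀ ∷ w)
                     ≡ on-hyperplane x x′ (k + toℕ a * toℕ w₀) (k′ + toℕ a′ * toℕ w₀) w
    regroup w₀ w = cong₂ (λ u v → 𝟙 (u mod p Fin.≟ v mod p))
      (sym (+-assoc k (toℕ a * toℕ w₀) ⟨ x , w ⟩)) (sym (+-assoc k′ (toℕ a′ * toℕ w₀) ⟨ x′ , w ⟩))
    by-tails : Dec (x ≡ x′) →
      p * ∑ₗ 𝔽ₚ (λ w₀ → ∑ₗ (𝔽ₚ^ m) (on-hyperplane x x′ (k + toℕ a * toℕ w₀) (k′ + toℕ a′ * toℕ w₀))) ≤ p * p ^ m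
    by-tails (no x≢x′) = begin
      p * ∑ₗ 𝔽ₚ (λ w₀ → ∑ₗ (𝔽ₚ^ m) (on-hyperplane x x′ _ _))   ≡⟨ ∑ₗ-*ˡ 𝔽ₚ p _ ⟨
      ∑ₗ 𝔽ₚ (λ w₀ → p * ∑ₗ (𝔽ₚ^ m) (on-hyperplane x x′ _ _))   ≤⟨ ∑ₗ-mono-≤ 𝔽ₚ (λ w₀ → hyperplane-bound x x′ _ _ x≢x′) ⟩
      ∑ₗ 𝔽ₚ (λ _ → p ^ m)                                      ≡⟨ ∑ₗ-allFin-const p (p ^ m) ⟩
      p * p ^ m                                                ∎
    by-tails (yes refl) = *-monoʳ-≤ p (begin
      ∑ₗ 𝔽ₚ (λ w₀ → ∑ₗ (𝔽ₚ^ m) (on-hyperplane x x _ _))   ≡⟨ ∑ₗ-comm 𝔽ₚ (𝔽ₚ^ m) _ ⟩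
      ∑ₗ (𝔽ₚ^ m) (λ w → ∑ₗ 𝔽ₚ (λ w₀ → on-hyperplane x x _ _ w))  ≤⟨ ∑ₗ-mono-≤ (𝔽ₚ^ m) at-most-one ⟩
      ∑ₗ (𝔽ₚ^ m) (λ _ → 1)                                ≡⟨ ∑ₗ-Finⁿ-const p m 1 ⟩
      p ^ m * 1                                           ≡⟨ *-identityʳ (p ^ m) ⟩
      p ^ m                                               ∎)
      where
      a≢a′ : a ≢ a′
      a≢a′ a≡a′ = ax≢a′x′ (cong (_∷ x) a≡a′)
      at-most-one : ∀ w → ∑ₗ 𝔽ₚ (λ w₀ → on-hyperplane x x (k + toℕ a * toℕ w₀) (k′ + toℕ a′ * toℕ w₀) w) ≤ 1
      at-most-one w = Enumeration.∑ₗ-𝟙≤1 (Fin-enumeration p) (λ w₀ → _ Fin.≟ _) λ w₀ w₀′ r r′ →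
        affine-unique k k′ a≢a′ (drop-inner w₀ r) (drop-inner w₀′ r′)
        where
        drop-inner : ∀ w₀ → (k + toℕ a * toℕ w₀ + ⟨ x , w ⟩) mod p ≡ (k′ + toℕ a′ * toℕ w₀ + ⟨ x , w ⟩) mod p →
          (k + toℕ a * toℕ w₀) % p ≡ (k′ + toℕ a′ * toℕ w₀) % p
        drop-inner w₀ r = %-cancelʳ-+ _ _ ⟨ x , w ⟩ (mod≡⇒%≡ _ _ r)

-- Solutions of z₁ + z₂ + ⟨x, w⟩ + c(w) ≡ z

module Counting (p : ℕ) (pr : Prime p) (n : ℕ)
  {A C : Vec (Fin p) n → Set} (A? : Decidable A) (C? : Decidable C)
  (Z : Subset p) (c : Vec (Fin p) n → ℕ) (z : Fin p) where

  open Modular p pr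
  open Heis p pr n using (p≢0)

  private
    F : Set
    F = Fin p
    𝔽 : Enumeration F
    𝔽 = Fin-enumeration p
    𝔽ⁿ⁺¹ : Enumeration (Vec F (suc n))
    𝔽ⁿ⁺¹ = Vec-enumeration 𝔽 (suc n)
    δ : F → F → ℕ
    δ = Enumeration.δ 𝔽

  ∣Z∣ ∣A∣ ∣C∣ : ℕ
  ∣Z∣ = ∑ₗ 𝔽ₚ (λ t → 𝟙 (t ∈? Z))
  ∣A∣ = ∑ₗ (𝔽ₚ^ n) (λ x → 𝟙 (A? x))
  ∣C∣ = ∑ₗ (𝔽ₚ^ n) (λ w → 𝟙 (C? w))

  -- A vector z₁ ∷ x stands for the pair (z₁ , x) ∈ Z × A.
  Z×A : Vec F (suc n) → Set
  Z×A (z₁ ∷ x) = z₁ ∈ Z × A x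

  Z×A? : Decidable Z×A
  Z×A? (z₁ ∷ x) = z₁ ∈? Z ×-dec A? x

  private
    pairs : List (Vec F (suc n))
    pairs = 𝔽ₚ^ (suc n)
    χ : Vec F (suc n) → ℕ
    χ q = 𝟙 (Z×A? q)

  ∣Z×A∣ : ℕ
  ∣Z×A∣ = ∑ₗ pairs χ

  ∣Z×A∣≡∣Z∣*∣A∣ : ∣Z×A∣ ≡ ∣Z∣ * ∣A∣
  ∣Z×A∣≡∣Z∣*∣A∣ = begin
    ∣Z×A∣                                                 ≡⟨ ∑ₗ-vectors 𝔽ₚ n _ ⟩
    ∑ₗ 𝔽ₚ (λ z₁ → ∑ₗ (𝔽ₚ^ n) (λ x → 𝟙 (z₁ ∈? Z ×-dec A? x))) ≡⟨ ∑ₗ-cong 𝔽ₚ (λ z₁ → ∑ₗ-cong (𝔽ₚ^ n) (λ x → 𝟙-×-dec (z₁ ∈? Z) (A? x))) ⟩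
    ∑ₗ 𝔽ₚ (λ z₁ → ∑ₗ (𝔽ₚ^ n) (λ x → 𝟙 (z₁ ∈? Z) * 𝟙 (A? x))) ≡⟨ sym (∑ₗ-*-∑ₗ 𝔽ₚ (𝔽ₚ^ n) _ _) ⟩
    ∣Z∣ * ∣A∣                                             ∎
    where open ≡-Reasoning

  value : Vec F n → Vec F (suc n) → F
  value w (z₁ ∷ x) = (toℕ z₁ + ⟨ x , w ⟩) mod p

  representations : Vec F n → F → ℕ
  representations w s = ∑ₗ pairs (λ q → χ q * δ (value w q) s)

  completions : Vec F n → F → ℕ
  completions w s = ∑ₗ 𝔽ₚ (λ z₂ → 𝟙 (z₂ ∈? Z) * δ ((toℕ s + (toℕ z₂ + c w)) mod p) z)

  solutions : ℕ
  solutions = ∑ₗ (𝔽ₚ^ n) (λ w → 𝟙 (C? w) * ∑ₗ 𝔽ₚ (λ s → representations w s * completions w s))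

  collisions : Vec F n → ℕ
  collisions w = ∑ₗ 𝔽ₚ (λ s → representations w s * representations w s)

  support : Vec F n → ℕ
  support w = ∑ₗ 𝔽ₚ (λ s → 𝟙 (0 <? representations w s))

  ∑-representations : ∀ w → ∑ₗ 𝔽ₚ (representations w) ≡ ∣Z×A∣
  ∑-representations w = trans (∑ₗ-comm 𝔽ₚ pairs _)
    (∑ₗ-cong pairs (λ q → Enumeration.∑ₗ-δ 𝔽 (value w q) (λ _ → χ q)))

  collisions-as-pairs : ∀ w → collisions w ≡
    ∑ₗ pairs (λ q → ∑ₗ pairs (λ q′ → χ q * χ q′ * δ (value w q) (value w q′)))
  collisions-as-pairs w = begin
    ∑ₗ 𝔽ₚ (λ s → representations w s * representations w s)
      ≡⟨ ∑ₗ-cong 𝔽ₚ (λ s → ∑ₗ-*-∑ₗ pairs pairs _ _) ⟩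
    ∑ₗ 𝔽ₚ (λ s → ∑ₗ pairs (λ q → ∑ₗ pairs (λ q′ → term s q q′)))
      ≡⟨ ∑ₗ-comm 𝔽ₚ pairs _ ⟩
    ∑ₗ pairs (λ q → ∑ₗ 𝔽ₚ (λ s → ∑ₗ pairs (λ q′ → term s q q′)))
      ≡⟨ ∑ₗ-cong pairs (λ q → ∑ₗ-comm 𝔽ₚ pairs _) ⟩
    ∑ₗ pairs (λ q → ∑ₗ pairs (λ q′ → ∑ₗ 𝔽ₚ (λ s → term s q q′)))
      ≡⟨ ∑ₗ-cong pairs (λ q → ∑ₗ-cong pairs (sift q)) ⟩
    ∑ₗ pairs (λ q → ∑ₗ pairs (λ q′ → χ q * χ q′ * δ (value w q) (value w q′))) ∎
    where
    open ≡-Reasoning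
    term : F → Vec F (suc n) → Vec F (suc n) → ℕ
    term s q q′ = (χ q * δ (value w q) s) * (χ q′ * δ (value w q′) s)
    regroup : ∀ a d a′ d′ → (a * d) * (a′ * d′) ≡ a * a′ * d * d′
    regroup = solve-∀
    sift : ∀ q q′ → ∑ₗ 𝔽ₚ (λ s → term s q q′) ≡ χ q * χ q′ * δ (value w q) (value w q′)
    sift q q′ = trans (∑ₗ-cong 𝔽ₚ (λ s → regroup (χ q) (δ (value w q) s) (χ q′) (δ (value w q′) s)))
                      (Enumeration.∑ₗ-δ 𝔽 (value w q′) (λ s → χ q * χ q′ * δ (value w q) s))

  pair-collision-bound : ∀ q q′ → p * ∑ₗ (𝔽ₚ^ n) (λ w → δ (value w q) (value w q′))
                                   ≤ Enumeration.δ 𝔽ⁿ⁺¹ q q′ * p ^ suc n + p ^ n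
  pair-collision-bound (z₁ ∷ x) (z₁′ ∷ x′) with Vec.≡-dec Fin._≟_ x x′
  ... | no x≢x′ = ≤-trans (hyperplane-bound x x′ (toℕ z₁) (toℕ z₁′) x≢x′) (m≤n+m _ _)
  ... | yes refl with z₁ Fin.≟ z₁′
  ... | yes refl = begin
    p * ∑ₗ (𝔽ₚ^ n) (λ w → δ (value w q) (value w q))  ≤⟨ *-monoʳ-≤ p (∑ₗ-mono-≤ (𝔽ₚ^ n) (λ w → 𝟙≤1 (value w q Fin.≟ value w q))) ⟩
    p * ∑ₗ (𝔽ₚ^ n) (λ _ → 1)                          ≡⟨ cong (p *_) (trans (∑ₗ-Finⁿ-const p n 1) (*-identityʳ (p ^ n))) ⟩
    p ^ suc n                                         ≤⟨ m≤m+n (p ^ suc n) (p ^ n) ⟩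
    p ^ suc n + p ^ n                                 ≡⟨ cong (_+ p ^ n) (*-identityˡ (p ^ suc n)) ⟨
    1 * p ^ suc n + p ^ n                             ∎
    where
    open ≤-Reasoning
    q : Vec F (suc n)
    q = z₁ ∷ x
  ... | no z₁≢z₁′ = subst (_≤ 0 * p ^ suc n + p ^ n) (sym no-collision) z≤n
    where
    no-collision : p * ∑ₗ (𝔽ₚ^ n) (λ w → δ (value w (z₁ ∷ x)) (value w (z₁′ ∷ x))) ≡ 0
    no-collision = trans (cong (p *_) (trans (∑ₗ-cong (𝔽ₚ^ n) (λ w → 𝟙-no (_ Fin.≟ _) (z₁≢z₁′ ∘ cancel w)))
                                             (∑ₗ-zero (𝔽ₚ^ n))))
                         (*-zeroʳ p)
      where
      cancel : ∀ w → value w (z₁ ∷ x) ≡ value w (z₁′ ∷ x) → z₁ ≡ z₁′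
      cancel w eq = toℕ-%-injective z₁ z₁′ (%-cancelʳ-+ (toℕ z₁) (toℕ z₁′) ⟨ x , w ⟩ (mod≡⇒%≡ _ _ eq))

  second-moment : p * ∑ₗ (𝔽ₚ^ n) collisions ≤ ∣Z×A∣ * p ^ suc n + ∣Z×A∣ * (∣Z×A∣ * p ^ n)
  second-moment = begin
    p * ∑ₗ (𝔽ₚ^ n) collisions
      ≡⟨ cong (p *_) (∑ₗ-cong (𝔽ₚ^ n) collisions-as-pairs) ⟩
    p * ∑ₗ (𝔽ₚ^ n) (λ w → ∑ₗ pairs (λ q → ∑ₗ pairs (λ q′ → χ q * χ q′ * δ (value w q) (value w q′))))
      ≡⟨ cong (p *_) (trans (∑ₗ-comm (𝔽ₚ^ n) pairs _) (∑ₗ-cong pairs (λ q → ∑ₗ-comm (𝔽ₚ^ n) pairs _))) ⟩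
    p * ∑ₗ pairs (λ q → ∑ₗ pairs (λ q′ → ∑ₗ (𝔽ₚ^ n) (λ w → χ q * χ q′ * δ (value w q) (value w q′))))
      ≡⟨ ∑ₗ-*ˡ pairs p _ ⟨
    ∑ₗ pairs (λ q → p * ∑ₗ pairs (λ q′ → ∑ₗ (𝔽ₚ^ n) (λ w → χ q * χ q′ * δ (value w q) (value w q′))))
      ≡⟨ ∑ₗ-cong pairs (λ q → trans (sym (∑ₗ-*ˡ pairs p _)) (∑ₗ-cong pairs (λ q′ → pull-weights q q′))) ⟩
    ∑ₗ pairs (λ q → ∑ₗ pairs (λ q′ → χ q * χ q′ * (p * ∑ₗ (𝔽ₚ^ n) (λ w → δ (value w q) (value w q′)))))
      ≤⟨ ∑ₗ-mono-≤ pairs (λ q → ∑ₗ-mono-≤ pairs (λ q′ → *-monoʳ-≤ (χ q * χ q′) (pair-collision-bound q q′))) ⟩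
    ∑ₗ pairs (λ q → ∑ₗ pairs (λ q′ → χ q * χ q′ * (Enumeration.δ 𝔽ⁿ⁺¹ q q′ * p ^ suc n + p ^ n)))
      ≡⟨ Enumeration.∑ₗ-pairs-δ 𝔽ⁿ⁺¹ Z×A? (p ^ suc n) (p ^ n) ⟩
    ∣Z×A∣ * p ^ suc n + ∣Z×A∣ * (∣Z×A∣ * p ^ n) ∎
    where
    open ≤-Reasoning
    pull-weights : ∀ q q′ → p * ∑ₗ (𝔽ₚ^ n) (λ w → χ q * χ q′ * δ (value w q) (value w q′))
                          ≡ χ q * χ q′ * (p * ∑ₗ (𝔽ₚ^ n) (λ w → δ (value w q) (value w q′)))
    pull-weights q q′ = trans (cong (p *_) (∑ₗ-*ˡ (𝔽ₚ^ n) (χ q * χ q′) _)) (*-x∙yz≈y∙xz p (χ q * χ q′) _)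

  ∣Z×A∣²≤support*collisions : ∀ w → ∣Z×A∣ * ∣Z×A∣ ≤ support w * collisions w
  ∣Z×A∣²≤support*collisions w = subst (λ k → k * k ≤ support w * collisions w) (∑-representations w)
    (cauchy-schwarz-support 𝔽ₚ (representations w))

  support≤p : ∀ w → support w ≤ p
  support≤p w = ∑ₗ-allFin-𝟙≤n p (λ s → 0 <? representations w s)

  ∑-completions : ∀ w → ∑ₗ 𝔽ₚ (completions w) ≡ ∣Z∣
  ∑-completions w = begin
    ∑ₗ 𝔽ₚ (λ s → ∑ₗ 𝔽ₚ (λ z₂ → 𝟙 (z₂ ∈? Z) * δ ((toℕ s + (toℕ z₂ + c w)) mod p) z))
      ≡⟨ ∑ₗ-comm 𝔽ₚ 𝔽ₚ _ ⟩
    ∑ₗ 𝔽ₚ (λ z₂ → ∑ₗ 𝔽ₚ (λ s → 𝟙 (z₂ ∈? Z) * δ ((toℕ s + (toℕ z₂ + c w)) mod p) z))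
      ≡⟨ ∑ₗ-cong 𝔽ₚ (λ z₂ → trans (∑ₗ-*ˡ 𝔽ₚ (𝟙 (z₂ ∈? Z)) _)
                                  (cong (𝟙 (z₂ ∈? Z) *_) (translate-once (toℕ z₂ + c w) z))) ⟩
    ∑ₗ 𝔽ₚ (λ z₂ → 𝟙 (z₂ ∈? Z) * 1)
      ≡⟨ ∑ₗ-cong 𝔽ₚ (λ z₂ → *-identityʳ (𝟙 (z₂ ∈? Z))) ⟩
    ∣Z∣ ∎
    where open ≡-Reasoning

  completions≤1 : ∀ w s → completions w s ≤ 1
  completions≤1 w s = begin
    ∑ₗ 𝔽ₚ (λ z₂ → 𝟙 (z₂ ∈? Z) * δ ((toℕ s + (toℕ z₂ + c w)) mod p) z)
      ≤⟨ ∑ₗ-mono-≤ 𝔽ₚ (λ z₂ → 𝟙*m≤m (z₂ ∈? Z) _) ⟩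
    ∑ₗ 𝔽ₚ (λ z₂ → δ ((toℕ s + (toℕ z₂ + c w)) mod p) z)
      ≡⟨ ∑ₗ-cong 𝔽ₚ (λ z₂ → cong (λ k → δ (k mod p) z) (+-x∙yz≈y∙xz (toℕ s) (toℕ z₂) (c w))) ⟩
    ∑ₗ 𝔽ₚ (λ z₂ → δ ((toℕ z₂ + (toℕ s + c w)) mod p) z)
      ≡⟨ translate-once (toℕ s + c w) z ⟩
    1 ∎
    where open ≤-Reasoning

  support+∣Z∣≤p : ∀ w → ∑ₗ 𝔽ₚ (λ s → representations w s * completions w s) ≡ 0 → support w + ∣Z∣ ≤ p
  support+∣Z∣≤p w none = begin
    support w + ∣Z∣                                                   ≡⟨ cong (support w +_) (∑-completions w) ⟨
    support w + ∑ₗ 𝔽ₚ (completions w)                                 ≡⟨ ∑ₗ-distrib-+ 𝔽ₚ _ _ ⟨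
    ∑ₗ 𝔽ₚ (λ s → 𝟙 (0 <? representations w s) + completions w s)     ≤⟨ ∑ₗ-mono-≤ 𝔽ₚ disjoint ⟩
    ∑ₗ 𝔽ₚ (λ _ → 1)                                                   ≡⟨ trans (∑ₗ-allFin-const p 1) (*-identityʳ p) ⟩
    p                                                                 ∎
    where
    open ≤-Reasoning
    disjoint : ∀ s → 𝟙 (0 <? representations w s) + completions w s ≤ 1
    disjoint s with representations w s | Enumeration.∑ₗ≡0⇒≡0 𝔽 _ none s
    ... | zero  | _     = completions≤1 w s
    ... | suc r | rc≡0 = ≤-reflexive (cong suc (m*n≡0⇒m≡0 (completions w s) (suc r) (trans (*-comm _ (suc r)) rc≡0)))

  K : ℕ
  K = p ∸ ∣Z∣

  no-solutions-at : solutions ≡ 0 → ∀ w → C w → ∑ₗ 𝔽ₚ (λ s → representations w s * completions w s) ≡ 0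
  no-solutions-at none w Cw = trans (sym (+-identityʳ _))
    (subst (λ k → k * ∑ₗ 𝔽ₚ (λ s → representations w s * completions w s) ≡ 0) (𝟙-yes (C? w) Cw)
      (Enumeration.∑ₗ≡0⇒≡0 (Vec-enumeration 𝔽 n) _ none w))

  weighted-bound : solutions ≡ 0 → ∀ w →
    (K + 𝟙 (C? w) * ∣Z∣) * (∣Z×A∣ * ∣Z×A∣) ≤ p * K * collisions w
  weighted-bound none w with C? w
  ... | yes Cw = begin
    (K + 1 * ∣Z∣) * (∣Z×A∣ * ∣Z×A∣)   ≡⟨ cong (λ k → (K + k) * (∣Z×A∣ * ∣Z×A∣)) (*-identityˡ ∣Z∣) ⟩
    (K + ∣Z∣) * (∣Z×A∣ * ∣Z×A∣)       ≡⟨ cong (_* (∣Z×A∣ * ∣Z×A∣)) (m∸n+n≡m (∑ₗ-allFin-𝟙≤n p (_∈? Z))) ⟩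
    p * (∣Z×A∣ * ∣Z×A∣)               ≤⟨ *-monoʳ-≤ p (∣Z×A∣²≤support*collisions w) ⟩
    p * (support w * collisions w)    ≤⟨ *-monoʳ-≤ p (*-monoˡ-≤ (collisions w) support≤K) ⟩
    p * (K * collisions w)            ≡⟨ *-assoc p K (collisions w) ⟨
    p * K * collisions w              ∎
    where
    open ≤-Reasoning
    support≤K : support w ≤ K
    support≤K = m+n≤o⇒m≤o∸n (support w) (support+∣Z∣≤p w (no-solutions-at none w Cw))
  ... | no _ = begin
    (K + 0) * (∣Z×A∣ * ∣Z×A∣)         ≡⟨ cong (_* (∣Z×A∣ * ∣Z×A∣)) (+-identityʳ K) ⟩
    K * (∣Z×A∣ * ∣Z×A∣)               ≤⟨ *-monoʳ-≤ K (∣Z×A∣²≤support*collisions w) ⟩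
    K * (support w * collisions w)    ≤⟨ *-monoʳ-≤ K (*-monoˡ-≤ (collisions w) (support≤p w)) ⟩
    K * (p * collisions w)            ≡⟨ *-x∙yz≈y∙xz K p (collisions w) ⟩
    p * (K * collisions w)            ≡⟨ *-assoc p K (collisions w) ⟨
    p * K * collisions w              ∎
    where open ≤-Reasoning

  ∑-weights : ∑ₗ (𝔽ₚ^ n) (λ w → (K + 𝟙 (C? w) * ∣Z∣) * (∣Z×A∣ * ∣Z×A∣))
              ≡ p ^ n * (K * (∣Z×A∣ * ∣Z×A∣)) + ∣C∣ * (∣Z∣ * (∣Z×A∣ * ∣Z×A∣))
  ∑-weights = begin
    ∑ₗ (𝔽ₚ^ n) (λ w → (K + 𝟙 (C? w) * ∣Z∣) * S)             ≡⟨ ∑ₗ-cong (𝔽ₚ^ n) (λ w → distrib K (𝟙 (C? w)) ∣Z∣ S) ⟩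
    ∑ₗ (𝔽ₚ^ n) (λ w → K * S + 𝟙 (C? w) * (∣Z∣ * S))         ≡⟨ ∑ₗ-distrib-+ (𝔽ₚ^ n) _ _ ⟩
    ∑ₗ (𝔽ₚ^ n) (λ _ → K * S) + ∑ₗ (𝔽ₚ^ n) (λ w → 𝟙 (C? w) * (∣Z∣ * S))
                                                           ≡⟨ cong₂ _+_ (∑ₗ-Finⁿ-const p n (K * S)) (∑ₗ-*ʳ (𝔽ₚ^ n) (∣Z∣ * S) (λ w → 𝟙 (C? w))) ⟩
    p ^ n * (K * S) + ∣C∣ * (∣Z∣ * S)                      ∎
    where
    open ≡-Reasoning
    S : ℕ
    S = ∣Z×A∣ * ∣Z×A∣
    distrib : ∀ k e z s → (k + e * z) * s ≡ k * s + e * (z * s)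
    distrib = solve-∀

  ∑-weights-bound : solutions ≡ 0 →
    ∑ₗ (𝔽ₚ^ n) (λ w → (K + 𝟙 (C? w) * ∣Z∣) * (∣Z×A∣ * ∣Z×A∣))
      ≤ p ^ n * (K * (∣Z×A∣ * ∣Z×A∣)) + K * (∣Z×A∣ * p ^ suc n)
  ∑-weights-bound none = begin
    ∑ₗ (𝔽ₚ^ n) (λ w → (K + 𝟙 (C? w) * ∣Z∣) * (∣Z×A∣ * ∣Z×A∣))  ≤⟨ ∑ₗ-mono-≤ (𝔽ₚ^ n) (weighted-bound none) ⟩
    ∑ₗ (𝔽ₚ^ n) (λ w → p * K * collisions w)                    ≡⟨ ∑ₗ-*ˡ (𝔽ₚ^ n) (p * K) collisions ⟩
    p * K * ∑ₗ (𝔽ₚ^ n) collisions                              ≡⟨ swap p K (∑ₗ (𝔽ₚ^ n) collisions) ⟩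
    K * (p * ∑ₗ (𝔽ₚ^ n) collisions)                            ≤⟨ *-monoʳ-≤ K second-moment ⟩
    K * (∣Z×A∣ * p ^ suc n + ∣Z×A∣ * (∣Z×A∣ * p ^ n))          ≡⟨ expand K ∣Z×A∣ (p ^ suc n) (p ^ n) ⟩
    p ^ n * (K * (∣Z×A∣ * ∣Z×A∣)) + K * (∣Z×A∣ * p ^ suc n)    ∎
    where
    open ≤-Reasoning
    swap : ∀ p k s → p * k * s ≡ k * (p * s)
    swap = solve-∀
    expand : ∀ k N P₁ P₀ → k * (N * P₁ + N * (N * P₀)) ≡ P₀ * (k * (N * N)) + k * (N * P₁)
    expand = solve-∀

  no-solutions-bound : solutions ≡ 0 → ∣Z∣ ^ 2 * (∣A∣ * ∣C∣) ≤ p ^ (n + 2)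
  no-solutions-bound none = begin
    ∣Z∣ ^ 2 * (∣A∣ * ∣C∣)   ≡⟨ trans (reorder ∣Z∣ ∣A∣ ∣C∣) (cong (∣C∣ * ∣Z∣ *_) (sym ∣Z×A∣≡∣Z∣*∣A∣)) ⟩
    ∣C∣ * ∣Z∣ * ∣Z×A∣       ≤⟨ *-cancel-square (∣C∣ * ∣Z∣) (K * p ^ suc n) ∣Z×A∣ cancelled ⟩
    K * p ^ suc n           ≤⟨ *-monoˡ-≤ (p ^ suc n) (m∸n≤m p ∣Z∣) ⟩
    p ^ (2 + n)             ≡⟨ cong (p ^_) (+-comm 2 n) ⟩
    p ^ (n + 2)             ∎
    where
    open ≤-Reasoning
    reorder : ∀ t a b → t * (t * 1) * (a * b) ≡ b * t * (t * a)
    reorder = solve-∀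
    regroup : ∀ k N P₁ → k * (N * P₁) ≡ k * P₁ * N
    regroup = solve-∀
    cancelled : ∣C∣ * ∣Z∣ * (∣Z×A∣ * ∣Z×A∣) ≤ K * p ^ suc n * ∣Z×A∣
    cancelled = subst₂ _≤_ (sym (*-assoc ∣C∣ ∣Z∣ _)) (regroup K ∣Z×A∣ (p ^ suc n))
      (+-cancelˡ-≤ _ _ _ (subst (_≤ p ^ n * (K * (∣Z×A∣ * ∣Z×A∣)) + K * (∣Z×A∣ * p ^ suc n))
                                ∑-weights (∑-weights-bound none)))

  record Solution : Set where
    field
      x w       : Vec F n
      z₁ z₂     : F
      x∈A       : A x
      w∈C       : C w
      z₁∈Z      : z₁ ∈ Z
      z₂∈Z      : z₂ ∈ Z
      sums-to-z : (toℕ z₁ + toℕ z₂ + ⟨ x , w ⟩ + c w) mod p ≡ z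

  chain-sum : ∀ {x w} {z₁ z₂ s : F} → value w (z₁ ∷ x) ≡ s → (toℕ s + (toℕ z₂ + c w)) mod p ≡ z →
    (toℕ z₁ + toℕ z₂ + ⟨ x , w ⟩ + c w) mod p ≡ z
  chain-sum {x} {w} {z₁} {z₂} {s} value≡s s+z₂+c≡z = trans (%≡⇒mod≡ _ _ (begin
    (toℕ z₁ + toℕ z₂ + ⟨ x , w ⟩ + c w) % p       ≡⟨ cong (_% p) (shuffle (toℕ z₁) (toℕ z₂) ⟨ x , w ⟩ (c w)) ⟩
    (toℕ z₁ + ⟨ x , w ⟩ + (toℕ z₂ + c w)) % p     ≡⟨ %-absorbˡ-+ (toℕ z₁ + ⟨ x , w ⟩) _ ⟨
    ((toℕ z₁ + ⟨ x , w ⟩) % p + (toℕ z₂ + c w)) % p ≡⟨ cong (λ r → (r + (toℕ z₂ + c w)) % p) value%p≡s ⟩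
    (toℕ s + (toℕ z₂ + c w)) % p                  ∎)) s+z₂+c≡z
    where
    open ≡-Reasoning
    shuffle : ∀ a b i e → a + b + i + e ≡ a + i + (b + e)
    shuffle = solve-∀
    value%p≡s : (toℕ z₁ + ⟨ x , w ⟩) % p ≡ toℕ s
    value%p≡s = trans (sym (toℕ-mod (toℕ z₁ + ⟨ x , w ⟩))) (cong toℕ value≡s)

  solution : 0 < solutions → Solution
  solution pos
    with ∑ₗ-positive (𝔽ₚ^ n) (λ w → 𝟙 (C? w) * ∑ₗ 𝔽ₚ (λ s → representations w s * completions w s)) pos
  ... | w , pos-w with m*n>0⇒m>0×n>0 (𝟙 (C? w)) _ pos-w
  ... | w∈C , pos-∑ with ∑ₗ-positive 𝔽ₚ (λ s → representations w s * completions w s) pos-∑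
  ... | s , pos-s with m*n>0⇒m>0×n>0 (representations w s) (completions w s) pos-s
  ... | pos-r , pos-c
    with ∑ₗ-positive pairs (λ q → χ q * δ (value w q) s) pos-r
       | ∑ₗ-positive 𝔽ₚ (λ z₂ → 𝟙 (z₂ ∈? Z) * δ ((toℕ s + (toℕ z₂ + c w)) mod p) z) pos-c
  ... | z₁ ∷ x , pos-q | z₂ , pos-z₂
    with m*n>0⇒m>0×n>0 (χ (z₁ ∷ x)) _ pos-q | m*n>0⇒m>0×n>0 (𝟙 (z₂ ∈? Z)) _ pos-z₂
  ... | q∈Z×A , value≡s | z₂∈Z , sum≡z = record
    { x = x ; w = w ; z₁ = z₁ ; z₂ = z₂
    ; x∈A = proj₂ (𝟙>0⇒ (Z×A? (z₁ ∷ x)) q∈Z×A)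
    ; w∈C = 𝟙>0⇒ (C? w) w∈C
    ; z₁∈Z = proj₁ (𝟙>0⇒ (Z×A? (z₁ ∷ x)) q∈Z×A)
    ; z₂∈Z = 𝟙>0⇒ (z₂ ∈? Z) z₂∈Z
    ; sums-to-z = chain-sum {x} {w} {z₁} {z₂} (𝟙>0⇒ (value w (z₁ ∷ x) Fin.≟ s) value≡s)
                            (𝟙>0⇒ ((toℕ s + (toℕ z₂ + c w)) mod p Fin.≟ z) sum≡z)
    }

  covering : p ^ (n + 2) < ∣Z∣ ^ 2 * (∣A∣ * ∣C∣) → Solution
  covering large with 0 <? solutions
  ... | yes pos  = solution pos
  ... | no ¬pos = ⊥-elim (<⇒≱ large (no-solutions-bound (n≤0⇒n≡0 (≮⇒≥ ¬pos))))

-- Bricks in Mₙ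

module Brick (p : ℕ) (pr : Prime p) (n : ℕ) where

  open Heis p pr n
  open Modular p pr

  ⊖-⊕-cancel : ∀ a x → (a ⊖ x) ⊕ x ≡ a
  ⊖-⊕-cancel a x = Fin.toℕ-injective (begin
    toℕ ((a ⊖ x) ⊕ x)                          ≡⟨ toℕ-mod _ ⟩
    (toℕ (a ⊖ x) + toℕ x) % p                  ≡⟨ cong (λ r → (r + toℕ x) % p) (toℕ-mod _) ⟩
    ((toℕ a + (p ∸ toℕ x)) % p + toℕ x) % p    ≡⟨ %-absorbˡ-+ (toℕ a + (p ∸ toℕ x)) (toℕ x) ⟩
    (toℕ a + (p ∸ toℕ x) + toℕ x) % p          ≡⟨ cong (_% p) (+-assoc (toℕ a) (p ∸ toℕ x) (toℕ x)) ⟩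
    (toℕ a + (p ∸ toℕ x + toℕ x)) % p          ≡⟨ cong (λ k → (toℕ a + k) % p) (m∸n+n≡m (<⇒≤ (Fin.toℕ<n x))) ⟩
    (toℕ a + p) % p                            ≡⟨ [m+n]%n≡m%n (toℕ a) p ⟩
    toℕ a % p                                  ≡⟨ m<n⇒m%n≡m (Fin.toℕ<n a) ⟩
    toℕ a                                      ∎)
    where open ≡-Reasoning

  ⊕-comm : ∀ x y → x ⊕ y ≡ y ⊕ x
  ⊕-comm x y = cong (_mod p) (+-comm (toℕ x) (toℕ y))

  _⊖ᵛ_ : ∀ {m} → Vec F m → Vec F m → Vec F m
  _⊖ᵛ_ = zipWith _⊖_

  ⊖ᵛ-⊕-cancel : ∀ {m} (a x : Vec F m) → zipWith _⊕_ (a ⊖ᵛ x) x ≡ a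
  ⊖ᵛ-⊕-cancel []       []       = refl
  ⊖ᵛ-⊕-cancel (a ∷ as) (x ∷ xs) = cong₂ _∷_ (⊖-⊕-cancel a x) (⊖ᵛ-⊕-cancel as xs)

  ⊕-⊖ᵛ-cancel : ∀ {m} (a x : Vec F m) → zipWith _⊕_ x (a ⊖ᵛ x) ≡ a
  ⊕-⊖ᵛ-cancel a x = trans (Vec.zipWith-comm ⊕-comm x (a ⊖ᵛ x)) (⊖ᵛ-⊕-cancel a x)

  reflections-product : ∀ a b x w z₁ z₂ →
    (x , b ⊖ᵛ w , z₁) · (a ⊖ᵛ x , w , z₂) ≡ (a , b , (toℕ z₁ + toℕ z₂ + inner x w + carry (b ⊖ᵛ w) w) mod p)
  reflections-product a b x w z₁ z₂ = cong₂ _,_ (⊕-⊖ᵛ-cancel a x) (cong₂ _,_ (⊖ᵛ-⊕-cancel b w) refl)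

  ∈-reflection⁻ : ∀ (S : Subset p) {a t} → t ∈ S ∩ (a -ˢ S) → t ∈ S × a ⊖ t ∈ S
  ∈-reflection⁻ S {a} {t} t∈S∩a-S with x∈p∩q⁻ S (a -ˢ S) t∈S∩a-S
  ... | t∈S , t∈a-S = t∈S , Vec.lookup⇒[]= (a ⊖ t) S
    (trans (sym (Vec.lookup∘tabulate (λ t → lookup S (a ⊖ t)) t)) (Vec.[]=⇒lookup t∈a-S))

  InBox : (Fin n → Subset p) → Vec F n → Set
  InBox S x = ∀ i → lookup x i ∈ S i

  InBox? : (S : Fin n → Subset p) → Decidable (InBox S)
  InBox? S x = all? (λ i → lookup x i ∈? S i)

  ∣InBox∣ : (S : Fin n → Subset p) → ∑ₗ (𝔽ₚ^ n) (λ x → 𝟙 (InBox? S x)) ≡ ∏ n (λ i → ∣ S i ∣)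
  ∣InBox∣ S = begin
    ∑ₗ (𝔽ₚ^ n) (λ x → 𝟙 (InBox? S x))                         ≡⟨ ∑ₗ-cong (𝔽ₚ^ n) (λ x → 𝟙-all? (λ i → lookup x i ∈? S i)) ⟩
    ∑ₗ (𝔽ₚ^ n) (λ x → ∏ n (λ i → 𝟙 (lookup x i ∈? S i)))      ≡⟨ ∑ₗ-vectors-∏ 𝔽ₚ n (λ i t → 𝟙 (t ∈? S i)) ⟩
    ∏ n (λ i → ∑ₗ 𝔽ₚ (λ t → 𝟙 (t ∈? S i)))                    ≡⟨ ∏-cong n (λ i → sym (∣S∣≡∑𝟙∈ (S i))) ⟩
    ∏ n (λ i → ∣ S i ∣)                                       ∎
    where open ≡-Reasoning

  reflection-pair : ∀ (S : Fin n → Subset p) a x →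
    InBox (λ i → S i ∩ (lookup a i -ˢ S i)) x → InBox S x × InBox S (a ⊖ᵛ x)
  reflection-pair S a x x∈ = (λ i → proj₁ (∈-reflection⁻ (S i) (x∈ i)))
    , (λ i → subst (_∈ S i) (sym (Vec.lookup-zipWith _⊖_ i a x)) (proj₂ (∈-reflection⁻ (S i) (x∈ i))))

lemma3p1 : (p : ℕ) (pr : Prime p) (n : ℕ) → 1 ≤ n →
    let open Heis p pr n in
    (X Y : Fin n → Subset p) (Z : Subset p) →
    (∀ i → Nonempty (X i)) → (∀ i → Nonempty (Y i)) → Nonempty Z →
    (a b : Vec F n) →
    ∣ Z ∣ ^ 2 * ∏ n (λ i → ∣ X i ∩ (Data.Vec.lookup a i -ˢ X i) ∣ * ∣ Y i ∩ (Data.Vec.lookup b i -ˢ Y i) ∣)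
      > 2 * p ^ (n + 2) →
    (z : F) → Σ M (λ g → Σ M (λ h →
      InBrick X Y Z g × InBrick X Y Z h × (g · h) ≡ (a , b , z)))
lemma3p1 p pr n _ X Y Z _ _ _ a b hyp z =
  (x , b ⊖ᵛ w , z₁) , (a ⊖ᵛ x , w , z₂) ,
  (x∈X , b⊖w∈Y , z₁∈Z) , (a⊖x∈X , w∈Y , z₂∈Z) ,
  trans (reflections-product a b x w z₁ z₂) (cong (λ t → a , b , t) sums-to-z)
  where
  open Heis p pr n
  open Brick p pr n
  X′ Y′ : Fin n → Subset p
  X′ i = X i ∩ (lookup a i -ˢ X i)
  Y′ i = Y i ∩ (lookup b i -ˢ Y i)
  open Counting p pr n (InBox? X′) (InBox? Y′) Z (λ w → carry (b ⊖ᵛ w) w) z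
  counts : ∣ Z ∣ ^ 2 * ∏ n (λ i → ∣ X′ i ∣ * ∣ Y′ i ∣) ≡ ∣Z∣ ^ 2 * (∣A∣ * ∣C∣)
  counts = cong₂ (λ u v → u ^ 2 * v) (∣S∣≡∑𝟙∈ Z)
    (trans (∏-distrib-* n _ _) (sym (cong₂ _*_ (∣InBox∣ X′) (∣InBox∣ Y′))))
  large : p ^ (n + 2) < ∣Z∣ ^ 2 * (∣A∣ * ∣C∣)
  large = ≤-<-trans (m≤m+n (p ^ (n + 2)) _) (subst (2 * p ^ (n + 2) <_) counts hyp)
  open Solution (covering large)
  x∈X : InBox X x
  x∈X = proj₁ (reflection-pair X a x x∈A)
  a⊖x∈X : InBox X (a ⊖ᵛ x)
  a⊖x∈X = proj₂ (reflection-pair X a x x∈A)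
  w∈Y : InBox Y w
  w∈Y = proj₁ (reflection-pair Y b w w∈C)
  b⊖w∈Y : InBox Y (b ⊖ᵛ w)
  b⊖w∈Y = proj₂ (reflection-pair Y b w w∈C)
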